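{- Let $t\ge 5$ be an odd integer, $d\ge t-3$ an integer, and $n=m\left(1+t\left(d-\frac{t-3}{2}\right)\right)$ with $m$ a positive integer. Then $\chi_d(C_n(2,t))=1+t\left(d-\frac{t-3}{2}\right)$.
   Context: For integers $n$ and $s_1,\ldots,s_k$, the circulant graph $C_n(s_1,\ldots,s_k)$ has vertex set $\{0,1,\ldots,n-1\}$, and each vertex $i$ is adjacent to $i+s_j \pmod n$ (and hence to $i-s_j\pmod n$) for every $j$. For a graph $G$ and a positive integer $d$, a $d$-distance $k$-coloring is a map $f:V(G)\to\{1,\ldots,k\}$ such that any two distinct vertices $u,v$ with $f(u)=f(v)$ satisfy $d_G(u,v)>d$ ($d_G$ the shortest-path distance); $\chi_d(G)$ is the smallest such $k$. -}

module Defs where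

open import Data.Nat using (ℕ; zero; suc; _+_; _*_; _≤_)
open import Data.Fin using (Fin; toℕ)
open import Data.List using (List)
open import Data.List.Membership.Propositional using (_∈_)
open import Data.Product using (∃; _×_)
open import Data.Sum using (_⊎_)
open import Relation.Binary.PropositionalEquality using (_≡_)
open import Relation.Nullary using (¬_)

_≡_[mod_] : ℕ → ℕ → ℕ → Set
a ≡ b [mod n ] = ∃ λ p → ∃ λ q → a + p * n ≡ b + q * n

CircAdj : (n : ℕ) → List ℕ → Fin n → Fin n → Set
CircAdj n S u v = ∃ λ s → s ∈ S × (toℕ v ≡ toℕ u + s [mod n ] ⊎ toℕ u ≡ toℕ v + s [mod n ])

data Walk {V : Set} (Adj : V → V → Set) : ℕ → V → V → Set where
  here : ∀ {u} → Walk Adj zero u u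
  step : ∀ {k u v w} → Adj u v → Walk Adj k v w → Walk Adj (suc k) u w

DistLe : {V : Set} → (V → V → Set) → V → V → ℕ → Set
DistLe Adj u v d = ∃ λ k → k ≤ d × Walk Adj k u v

IsDistColoring : {V : Set} → (V → V → Set) → (d k : ℕ) → (V → Fin k) → Set
IsDistColoring Adj d k f = ∀ u v → ¬ (u ≡ v) → f u ≡ f v → ¬ DistLe Adj u v d

HasDistColoring : {V : Set} → (V → V → Set) → (d k : ℕ) → Set
HasDistColoring Adj d k = ∃ λ f → IsDistColoring Adj d k f

ChiDist : {V : Set} → (V → V → Set) → (d c : ℕ) → Set
ChiDist Adj d c = HasDistColoring Adj d c × (∀ k → HasDistColoring Adj d k → c ≤ k)

module Submission where

-- Write t = 3 + 2h and d = h + k (so h ≤ k), c = 1 + tk and n = mc. A walk of length ℓ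
-- from u to v gives u + 2a + tb ≡ v + 2a′ + tb′ (mod n) with a + b + a′ + b′ = ℓ, and
-- conversely.
--
-- Upper bound: colour u by u mod c. Within the budget a + b + a′ + b′ ≤ h + k we have
-- 2a + tb ≤ t(h + k) < 2c, and 2a + tb = 2a′ + tb′ + c is impossible (by parity, or
-- because it costs more than h + k steps), so equal colours force 2a + tb = 2a′ + tb′,
-- hence u ≡ v (mod n).
--
-- Lower bound: for k ≥ 2 every 0 ≤ x ≤ tk can be written as 2a + tb − 2a′ − tb′ within
-- the budget, so the vertices 0, …, c − 1 are pairwise at distance at most d. This fails
-- only for t = 5, d = 2, where instead an exhaustive search shows that 16 consecutive
-- vertices (all of them when n = 6 or 12) admit no distance-2 colouring with 5 colours.

open import Defs
open import Data.Bool using (Bool; true; false; T; not; _∧_; _∨_)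
open import Data.Bool.ListAction using (any)
open import Data.Bool.Properties using (T-∧; T-∨; T-≡)
open import Data.Empty using (⊥; ⊥-elim)
open import Data.Fin using (Fin; toℕ; zero; suc; inject≤)
import Data.Fin.Properties as Fin
open import Data.List using (List; _∷_; []; length; upTo; applyDownFrom)
open import Data.List.Membership.Propositional using (_∈_; lose)
open import Data.List.Membership.Propositional.Properties using (∈-upTo⁺)
open import Data.List.Properties using (length-applyDownFrom)
open import Data.List.Relation.Unary.Any using (here; there)
open import Data.List.Relation.Unary.Any.Properties using (any⁺)
open import Data.Nat using (ℕ; zero; suc; _+_; _*_; _∸_; _/_; _%_; _≤_; _≥_; _<_; z≤n; s≤s; s≤s⁻¹; _≡ᵇ_; NonZero)
open import Data.Nat.DivMod
open import Data.Nat.Properties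
open import Algebra.Properties.CommutativeSemigroup +-commutativeSemigroup using (xy∙z≈xz∙y; xy∙z≈x∙zy)
open import Data.Nat.Tactic.RingSolver using (solve-∀)
open import Data.Product using (∃; ∃₂; _×_; _,_)
open import Data.Sum using (_⊎_; inj₁; inj₂)
open import Function using (_∘_)
open import Function.Bundles using (Equivalence)
open import Level using (0ℓ)
open import Relation.Binary.Bundles using (Setoid)
open import Relation.Binary.Definitions using (tri<; tri≈; tri>)
open import Relation.Binary.PropositionalEquality
import Relation.Binary.Reasoning.Setoid
open import Relation.Nullary using (¬_; yes; no)

mod-refl : ∀ {a n} → a ≡ a [mod n ]
mod-refl = 0 , 0 , refl

mod-sym : ∀ {a b n} → a ≡ b [mod n ] → b ≡ a [mod n ]
mod-sym (p , q , e) = q , p , sym e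

mod-trans : ∀ {a b c n} → a ≡ b [mod n ] → b ≡ c [mod n ] → a ≡ c [mod n ]
mod-trans {a} {b} {c} {n} (p , q , a≈b) (r , s , b≈c) = p + r , q + s , (begin
  a + (p + r) * n     ≡⟨ split a p r n ⟩
  a + p * n + r * n   ≡⟨ cong (_+ r * n) a≈b ⟩
  b + q * n + r * n   ≡⟨ xy∙z≈xz∙y b (q * n) (r * n) ⟩
  b + r * n + q * n   ≡⟨ cong (_+ q * n) b≈c ⟩
  c + s * n + q * n   ≡⟨ merge c s q n ⟩
  c + (q + s) * n     ∎)
  where
  open ≡-Reasoning
  split : ∀ a p r n → a + (p + r) * n ≡ a + p * n + r * n
  split = solve-∀
  merge : ∀ c s q n → c + s * n + q * n ≡ c + (q + s) * n
  merge = solve-∀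

≡⇒mod : ∀ {a b n} → a ≡ b → a ≡ b [mod n ]
≡⇒mod refl = mod-refl

modSetoid : ℕ → Setoid 0ℓ 0ℓ
modSetoid n = record
  { Carrier = ℕ
  ; _≈_ = λ a b → a ≡ b [mod n ]
  ; isEquivalence = record { refl = mod-refl ; sym = mod-sym ; trans = mod-trans }
  }

module ModReasoning (n : ℕ) = Relation.Binary.Reasoning.Setoid (modSetoid n)

+-congʳ-mod : ∀ {a b n} x → a ≡ b [mod n ] → (a + x) ≡ b + x [mod n ]
+-congʳ-mod {a} {b} {n} x (p , q , e) = p , q , (begin
  a + x + p * n   ≡⟨ xy∙z≈xz∙y a x (p * n) ⟩
  a + p * n + x   ≡⟨ cong (_+ x) e ⟩
  b + q * n + x   ≡⟨ xy∙z≈xz∙y b (q * n) x ⟩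
  b + x + q * n   ∎)
  where open ≡-Reasoning

+-cancelʳ-mod : ∀ {a b n} x → (a + x) ≡ b + x [mod n ] → a ≡ b [mod n ]
+-cancelʳ-mod {a} {b} {n} x (p , q , e) = p , q , +-cancelʳ-≡ x _ _ (begin
  a + p * n + x   ≡⟨ xy∙z≈xz∙y a (p * n) x ⟩
  a + x + p * n   ≡⟨ e ⟩
  b + x + q * n   ≡⟨ xy∙z≈xz∙y b x (q * n) ⟩
  b + q * n + x   ∎)
  where open ≡-Reasoning

%-mod : ∀ a n .{{_ : NonZero n}} → (a % n) ≡ a [mod n ]
%-mod a n = a / n , 0 , trans (sym (m≡m%n+[m/n]*n a n)) (sym (+-identityʳ a))

*-mod⇒mod : ∀ {a b} m c → a ≡ b [mod m * c ] → a ≡ b [mod c ]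
*-mod⇒mod {a} {b} m c (p , q , e) = p * m , q * m ,
  trans (cong (a +_) (*-assoc p m c)) (trans e (cong (b +_) (sym (*-assoc q m c))))

mod⇒≡ : ∀ {a b n} .{{_ : NonZero n}} → a < n → b < n → a ≡ b [mod n ] → a ≡ b
mod⇒≡ {a} {b} {n} a<n b<n (p , q , e) = begin
  a                ≡⟨ m<n⇒m%n≡m a<n ⟨
  a % n            ≡⟨ [m+kn]%n≡m%n a p n ⟨
  (a + p * n) % n  ≡⟨ cong (_% n) e ⟩
  (b + q * n) % n  ≡⟨ [m+kn]%n≡m%n b q n ⟩
  b % n            ≡⟨ m<n⇒m%n≡m b<n ⟩
  b                ∎
  where open ≡-Reasoning

%≡⇒mod : ∀ {a b n} .{{_ : NonZero n}} → a % n ≡ b % n → a ≡ b [mod n ]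
%≡⇒mod {a} {b} {n} e = mod-trans (mod-sym (%-mod a n)) (mod-trans (≡⇒mod e) (%-mod b n))

+-cancelˡ-mod : ∀ {a b x y n} → a ≡ b [mod n ] → (a + x) ≡ b + y [mod n ] → x ≡ y [mod n ]
+-cancelˡ-mod {a} {b} {x} {y} {n} a≈b a+x≈b+y = +-cancelʳ-mod a (begin
  x + a   ≡⟨ +-comm x a ⟩
  a + x   ≈⟨ a+x≈b+y ⟩
  b + y   ≈⟨ +-congʳ-mod y a≈b ⟨
  a + y   ≡⟨ +-comm a y ⟩
  y + a   ∎)
  where open ModReasoning n

mod⇒+* : ∀ {a b n} → a ≡ b [mod n ] → (∃ λ j → a ≡ b + j * n) ⊎ (∃ λ j → b ≡ a + j * n)
mod⇒+* {a} {b} {n} (p , q , e) with ≤-total p q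
... | inj₁ p≤q with j , refl ← m≤n⇒∃[o]m+o≡n p≤q = inj₁ (j , +-cancelʳ-≡ (p * n) _ _ (trans e (shift b p j n)))
  where
  shift : ∀ b p j n → b + (p + j) * n ≡ b + j * n + p * n
  shift = solve-∀
... | inj₂ q≤p with j , refl ← m≤n⇒∃[o]m+o≡n q≤p = inj₂ (j , +-cancelʳ-≡ (q * n) _ _ (trans (sym e) (shift a q j n)))
  where
  shift : ∀ a q j n → a + (q + j) * n ≡ a + j * n + q * n
  shift = solve-∀

_◅◅_ : ∀ {V : Set} {Adj : V → V → Set} {k l u v w} →
       Walk Adj k u v → Walk Adj l v w → Walk Adj (k + l) u w
here     ◅◅ q = q
step e p ◅◅ q = step e (p ◅◅ q)

m+o≡n⇒m≤n : ∀ {m n} o → m + o ≡ n → m ≤ n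
m+o≡n⇒m≤n {m} o refl = m≤m+n m o

module LinearCombination (s t : ℕ) where

  lin : ℕ → ℕ → ℕ
  lin a b = s * a + t * b

  lin-+ : ∀ a b a′ b′ → lin (a + a′) (b + b′) ≡ lin a b + lin a′ b′
  lin-+ a b a′ b′ = distrib s t a b a′ b′
    where
    distrib : ∀ s t a b a′ b′ → s * (a + a′) + t * (b + b′) ≡ (s * a + t * b) + (s * a′ + t * b′)
    distrib = solve-∀

  Representable : ℕ → ℕ → Set
  Representable d x = ∃₂ λ a b → ∃₂ λ a′ b′ → a + b + a′ + b′ ≤ d × x + lin a′ b′ ≡ lin a b

module Circulant (s t n′ : ℕ) where

  open LinearCombination s t

  n : ℕ
  n = suc n′

  Adj : Fin n → Fin n → Set
  Adj = CircAdj n (s ∷ t ∷ [])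

  vertex : ℕ → Fin n
  vertex x = x mod n

  toℕ-vertex : ∀ x → toℕ (vertex x) ≡ x [mod n ]
  toℕ-vertex x = subst (_≡ x [mod n ]) (sym (Fin.toℕ-fromℕ< (m%n<n x n))) (%-mod x n)

  mod⇒vertex≡ : ∀ {u v : Fin n} → toℕ u ≡ toℕ v [mod n ] → u ≡ v
  mod⇒vertex≡ {u} {v} e = Fin.toℕ-injective (mod⇒≡ (Fin.toℕ<n u) (Fin.toℕ<n v) e)

  generator-lin : ∀ {g} → g ∈ s ∷ t ∷ [] → ∃₂ λ a b → a + b ≡ 1 × lin a b ≡ g
  generator-lin (here refl)         = 1 , 0 , refl , unitˡ s t
    where
    unitˡ : ∀ s t → s * 1 + t * 0 ≡ s
    unitˡ = solve-∀
  generator-lin (there (here refl)) = 0 , 1 , refl , unitʳ s t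
    where
    unitʳ : ∀ s t → s * 0 + t * 1 ≡ t
    unitʳ = solve-∀

  walk⇒lin-mod : ∀ {ℓ u v} → Walk Adj ℓ u v →
    ∃₂ λ a b → ∃₂ λ a′ b′ → a + b + a′ + b′ ≡ ℓ × ((toℕ u + lin a b) ≡ toℕ v + lin a′ b′ [mod n ])
  walk⇒lin-mod here = 0 , 0 , 0 , 0 , refl , mod-refl
  walk⇒lin-mod {u = u} {v} (step {v = w} (g , g∈ , u~w) p)
    with a , b , a′ , b′ , length , w≈v ← walk⇒lin-mod p
       | x , y , x+y≡1 , lin≡g ← generator-lin g∈
    with u~w
  ... | inj₁ w≈u+g = x + a , y + b , a′ , b′ , trans (count x y a b a′ b′) (cong₂ _+_ x+y≡1 length) , (begin
    toℕ u + lin (x + a) (y + b)  ≡⟨ cong (toℕ u +_) (lin-+ x y a b) ⟩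
    toℕ u + (lin x y + lin a b)  ≡⟨ +-assoc (toℕ u) _ _ ⟨
    toℕ u + lin x y + lin a b    ≡⟨ cong (λ z → toℕ u + z + lin a b) lin≡g ⟩
    toℕ u + g + lin a b          ≈⟨ +-congʳ-mod (lin a b) w≈u+g ⟨
    toℕ w + lin a b              ≈⟨ w≈v ⟩
    toℕ v + lin a′ b′            ∎)
    where
    open ModReasoning n
    count : ∀ x y a b a′ b′ → x + a + (y + b) + a′ + b′ ≡ (x + y) + (a + b + a′ + b′)
    count = solve-∀
  ... | inj₂ u≈w+g = a , b , x + a′ , y + b′ , trans (count′ x y a b a′ b′) (cong₂ _+_ x+y≡1 length) , (begin
    toℕ u + lin a b              ≈⟨ +-congʳ-mod (lin a b) u≈w+g ⟩
    toℕ w + g + lin a b          ≡⟨ xy∙z≈xz∙y (toℕ w) g (lin a b) ⟩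
    toℕ w + lin a b + g          ≈⟨ +-congʳ-mod g w≈v ⟩
    toℕ v + lin a′ b′ + g        ≡⟨ cong (λ z → toℕ v + lin a′ b′ + z) lin≡g ⟨
    toℕ v + lin a′ b′ + lin x y  ≡⟨ xy∙z≈x∙zy (toℕ v) (lin a′ b′) (lin x y) ⟩
    toℕ v + (lin x y + lin a′ b′) ≡⟨ cong (toℕ v +_) (lin-+ x y a′ b′) ⟨
    toℕ v + lin (x + a′) (y + b′) ∎)
    where
    open ModReasoning n
    count′ : ∀ x y a b a′ b′ → a + b + (x + a′) + (y + b′) ≡ (x + y) + (a + b + a′ + b′)
    count′ = solve-∀

  -- Subtracting g is adding g * n′, since g * n ≡ 0 modulo n.
  vertex-+*n′-mod : ∀ x g → x ≡ toℕ (vertex (x + g * n′)) + g [mod n ]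
  vertex-+*n′-mod x g = mod-sym (begin
    toℕ (vertex (x + g * n′)) + g  ≈⟨ +-congʳ-mod g (toℕ-vertex _) ⟩
    x + g * n′ + g                 ≈⟨ 0 , g , wrap x g n′ ⟩
    x                              ∎)
    where
    open ModReasoning n
    wrap : ∀ u g n′ → u + g * n′ + g + 0 * suc n′ ≡ u + g * suc n′
    wrap = solve-∀

  forward-walk : ∀ {g} → g ∈ s ∷ t ∷ [] → ∀ j u →
    ∃ λ w → Walk Adj j u w × ((toℕ u + g * j) ≡ toℕ w [mod n ])
  forward-walk {g} g∈ zero    u = u , here , ≡⇒mod (trans (cong (toℕ u +_) (*-zeroʳ g)) (+-identityʳ _))
  forward-walk {g} g∈ (suc j) u with w , p , e ← forward-walk g∈ j (vertex (toℕ u + g)) =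
    w , step (g , g∈ , inj₁ (toℕ-vertex _)) p , (begin
      toℕ u + g * suc j                 ≡⟨ split (toℕ u) g j ⟩
      toℕ u + g + g * j                 ≈⟨ +-congʳ-mod (g * j) (toℕ-vertex _) ⟨
      toℕ (vertex (toℕ u + g)) + g * j  ≈⟨ e ⟩
      toℕ w                             ∎)
    where
    open ModReasoning n
    split : ∀ u g j → u + g * suc j ≡ u + g + g * j
    split = solve-∀

  backward-walk : ∀ {g} → g ∈ s ∷ t ∷ [] → ∀ j u →
    ∃ λ w → Walk Adj j u w × ((toℕ w + g * j) ≡ toℕ u [mod n ])
  backward-walk {g} g∈ zero    u = u , here , ≡⇒mod (trans (cong (toℕ u +_) (*-zeroʳ g)) (+-identityʳ _))
  backward-walk {g} g∈ (suc j) u with w , p , e ← backward-walk g∈ j (vertex (toℕ u + g * n′)) =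
    w , step (g , g∈ , inj₂ (vertex-+*n′-mod (toℕ u) g)) p , (begin
      toℕ w + g * suc j                       ≡⟨ split (toℕ w) g j ⟩
      toℕ w + g * j + g                       ≈⟨ +-congʳ-mod g e ⟩
      toℕ (vertex (toℕ u + g * n′)) + g        ≈⟨ vertex-+*n′-mod (toℕ u) g ⟨
      toℕ u                                   ∎)
    where
    open ModReasoning n
    split : ∀ w g j → w + g * suc j ≡ w + g * j + g
    split = solve-∀

  lin-mod⇒walk : ∀ a b a′ b′ u →
    ∃ λ w → Walk Adj (a + b + a′ + b′) u w × ((toℕ u + lin a b) ≡ toℕ w + lin a′ b′ [mod n ])
  lin-mod⇒walk a b a′ b′ u
    with w₁ , p₁ , e₁ ← forward-walk  (here refl)         a  u
    with w₂ , p₂ , e₂ ← forward-walk  (there (here refl)) b  w₁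
    with w₃ , p₃ , e₃ ← backward-walk (here refl)         a′ w₂
    with w₄ , p₄ , e₄ ← backward-walk (there (here refl)) b′ w₃
    = w₄ , ((p₁ ◅◅ p₂) ◅◅ p₃) ◅◅ p₄ , (begin
      toℕ u + (s * a + t * b)       ≡⟨ +-assoc (toℕ u) _ _ ⟨
      toℕ u + s * a + t * b         ≈⟨ +-congʳ-mod (t * b) e₁ ⟩
      toℕ w₁ + t * b                ≈⟨ e₂ ⟩
      toℕ w₂                        ≈⟨ e₃ ⟨
      toℕ w₃ + s * a′               ≈⟨ +-congʳ-mod (s * a′) e₄ ⟨
      toℕ w₄ + t * b′ + s * a′      ≡⟨ xy∙z≈x∙zy (toℕ w₄) (t * b′) (s * a′) ⟩
      toℕ w₄ + (s * a′ + t * b′)    ∎)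
    where open ModReasoning n

  lin-mod⇒DistLe : ∀ {u v d} a b a′ b′ → a + b + a′ + b′ ≤ d →
    (toℕ u + lin a b) ≡ toℕ v + lin a′ b′ [mod n ] → DistLe Adj u v d
  lin-mod⇒DistLe {u} {v} a b a′ b′ cost u≈v = arrive (lin-mod⇒walk a b a′ b′ u)
    where
    arrive : (∃ λ w → Walk Adj (a + b + a′ + b′) u w × ((toℕ u + lin a b) ≡ toℕ w + lin a′ b′ [mod n ])) →
             DistLe Adj u v _
    arrive (w , p , u≈w) = _ , cost , subst (Walk Adj _ u) w≡v p
      where
      w≡v : w ≡ v
      w≡v = mod⇒vertex≡ (+-cancelʳ-mod (lin a′ b′) (mod-trans (mod-sym u≈w) u≈v))

  representable⇒DistLe : ∀ {u v d x} → Representable d x →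
    (toℕ u + x) ≡ toℕ v [mod n ] → DistLe Adj u v d
  representable⇒DistLe {u} {v} {d} {x} (a , b , a′ , b′ , cost , x+lin′≡lin) u+x≈v =
    lin-mod⇒DistLe a b a′ b′ cost (begin
      toℕ u + lin a b           ≡⟨ cong (toℕ u +_) x+lin′≡lin ⟨
      toℕ u + (x + lin a′ b′)   ≡⟨ +-assoc (toℕ u) x _ ⟨
      toℕ u + x + lin a′ b′     ≈⟨ +-congʳ-mod (lin a′ b′) u+x≈v ⟩
      toℕ v + lin a′ b′         ∎)
    where open ModReasoning n

  representable⇒DistLe⁻ : ∀ {u v d x} → Representable d x →
    (toℕ v + x) ≡ toℕ u [mod n ] → DistLe Adj u v d
  representable⇒DistLe⁻ {u} {v} {d} {x} (a , b , a′ , b′ , cost , x+lin′≡lin) v+x≈u =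
    lin-mod⇒DistLe a′ b′ a b (subst (_≤ d) (reorder a b a′ b′) cost) (begin
      toℕ u + lin a′ b′         ≈⟨ +-congʳ-mod (lin a′ b′) v+x≈u ⟨
      toℕ v + x + lin a′ b′     ≡⟨ +-assoc (toℕ v) x _ ⟩
      toℕ v + (x + lin a′ b′)   ≡⟨ cong (toℕ v +_) x+lin′≡lin ⟩
      toℕ v + lin a b           ∎)
    where
    open ModReasoning n
    reorder : ∀ a b a′ b′ → a + b + a′ + b′ ≡ a′ + b′ + a + b
    reorder = solve-∀

module Arithmetic (h k : ℕ) where

  t c : ℕ
  t = 3 + 2 * h
  c = suc (t * k)

  open LinearCombination 2 t

  lin≤t*[a+b] : ∀ a b → lin a b ≤ t * (a + b)
  lin≤t*[a+b] a b = begin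
    2 * a + t * b   ≤⟨ +-monoˡ-≤ (t * b) (*-monoˡ-≤ a (m≤m+n 2 (1 + 2 * h))) ⟩
    t * a + t * b   ≡⟨ *-distribˡ-+ t a b ⟨
    t * (a + b)     ∎
    where open ≤-Reasoning

  lin<2c : h ≤ k → ∀ a b → a + b ≤ h + k → lin a b < 2 * c
  lin<2c h≤k a b a+b≤h+k = begin-strict
    lin a b         ≤⟨ lin≤t*[a+b] a b ⟩
    t * (a + b)     ≤⟨ *-monoʳ-≤ t (≤-trans a+b≤h+k (+-monoˡ-≤ k h≤k)) ⟩
    t * (k + k)     <⟨ m+o≡n⇒m≤n 1 (double t k) ⟩
    2 * c           ∎
    where
    open ≤-Reasoning
    double : ∀ t k → suc (t * (k + k)) + 1 ≡ 2 * suc (t * k)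
    double = solve-∀

  lin+c≡ : ∀ a′ b′ → lin a′ b′ + 1 * c ≡ suc (2 * a′ + t * (b′ + k))
  lin+c≡ a′ b′ = collect a′ b′ t k
    where
    collect : ∀ a′ b′ t k → 2 * a′ + t * b′ + 1 * suc (t * k) ≡ suc (2 * a′ + t * (b′ + k))
    collect = solve-∀

  wrap-balanced : ∀ a a′ b′ → 2 * a + t * (b′ + k) ≢ suc (2 * a′ + t * (b′ + k))
  wrap-balanced a a′ b′ E = even≢odd a a′ (+-cancelʳ-≡ (t * (b′ + k)) _ _ E)

  wrap-above : ∀ a b a′ b′ → b′ + k < b → 2 * a + t * b ≡ suc (2 * a′ + t * (b′ + k)) → h + k < a′ + b
  wrap-above a b a′ b′ b′+k<b E with e , refl ← m≤n⇒∃[o]m+o≡n b′+k<b =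
    +-mono-≤ h<a′ (≤-trans (m≤n+m k b′) (≤-trans (n≤1+n _) (m≤m+n _ e)))
    where
    t≤1+2a′ : t ≤ suc (2 * a′)
    t≤1+2a′ = +-cancelʳ-≤ (t * (b′ + k)) t (suc (2 * a′)) (begin
      t + t * (b′ + k)                  ≤⟨ m+o≡n⇒m≤n (2 * a + t * e) (expand a b′ k e t) ⟩
      2 * a + t * (suc (b′ + k) + e)    ≡⟨ E ⟩
      suc (2 * a′) + t * (b′ + k)       ∎)
      where
      open ≤-Reasoning
      expand : ∀ a b′ k e t → t + t * (b′ + k) + (2 * a + t * e) ≡ 2 * a + t * (suc (b′ + k) + e)
      expand = solve-∀
    h<a′ : suc h ≤ a′
    h<a′ = *-cancelˡ-≤ 2 (subst (_≤ 2 * a′) (double h) (s≤s⁻¹ t≤1+2a′))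
      where
      double : ∀ h → suc (suc (2 * h)) ≡ 2 * suc h
      double = solve-∀

  wrap-below : ∀ a b a′ b′ → b < b′ + k → 2 * a + t * b ≡ suc (2 * a′ + t * (b′ + k)) → h + k < a + b
  wrap-below a b a′ b′ b<b′+k E with g , b+1+g≡b′+k ← m≤n⇒∃[o]m+o≡n b<b′+k = begin-strict
    h + k               ≤⟨ +-monoʳ-≤ h (m≤n+m k b′) ⟩
    h + (b′ + k)        <⟨ ≤-reflexive (trans (cong (λ z → suc (h + z)) (sym b+1+g≡b′+k)) (regroup h g b)) ⟩
    h + 2 + g + b       ≤⟨ +-monoˡ-≤ b h+2+g≤a ⟩
    a + b               ∎
    where
    open ≤-Reasoning
    regroup : ∀ h g b → suc (h + (suc b + g)) ≡ h + 2 + g + b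
    regroup = solve-∀
    h+2+g≤a : h + 2 + g ≤ a
    h+2+g≤a = *-cancelˡ-≤ 2 (+-cancelʳ-≤ (t * b) (2 * (h + 2 + g)) (2 * a) (begin
      2 * (h + 2 + g) + t * b           ≤⟨ m+o≡n⇒m≤n (2 * a′ + (1 + 2 * h) * g) (expand h g a′ b) ⟩
      suc (2 * a′ + t * (suc b + g))    ≡⟨ cong (λ z → suc (2 * a′ + t * z)) b+1+g≡b′+k ⟩
      suc (2 * a′ + t * (b′ + k))       ≡⟨ E ⟨
      2 * a + t * b                     ∎))
      where
      expand : ∀ h g a′ b → 2 * (h + 2 + g) + (3 + 2 * h) * b + (2 * a′ + (1 + 2 * h) * g)
                            ≡ suc (2 * a′ + (3 + 2 * h) * (suc b + g))
      expand = solve-∀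

  -- Compare b with b′ + k: equality is impossible by parity (t is odd), and otherwise
  -- the extra multiple of t has to be paid for by more than h + k steps.
  single-wrap : ∀ a b a′ b′ → a + b + a′ + b′ ≤ h + k → lin a b ≢ lin a′ b′ + 1 * c
  single-wrap a b a′ b′ cost E′ with <-cmp b (b′ + k) | trans E′ (lin+c≡ a′ b′)
  ... | tri≈ _ refl _   | E = wrap-balanced a a′ b′ E
  ... | tri> _ _ b′+k<b | E = <⇒≱ (wrap-above a b a′ b′ b′+k<b E) (≤-trans (m+o≡n⇒m≤n (a + b′) (reorder a b a′ b′)) cost)
    where
    reorder : ∀ a b a′ b′ → a′ + b + (a + b′) ≡ a + b + a′ + b′
    reorder = solve-∀
  ... | tri< b<b′+k _ _ | E = <⇒≱ (wrap-below a b a′ b′ b<b′+k E) (≤-trans (≤-trans (m≤m+n (a + b) a′) (m≤m+n _ b′)) cost)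

  no-wrap : h ≤ k → ∀ a b a′ b′ j → a + b + a′ + b′ ≤ h + k → lin a b ≡ lin a′ b′ + j * c → lin a b ≡ lin a′ b′
  no-wrap h≤k a b a′ b′ zero          cost E = trans E (+-identityʳ _)
  no-wrap h≤k a b a′ b′ (suc zero)    cost E = ⊥-elim (single-wrap a b a′ b′ cost E)
  no-wrap h≤k a b a′ b′ (suc (suc j)) cost E = ⊥-elim (<⇒≱ (lin<2c h≤k a b a+b≤h+k) 2c≤lin)
    where
    a+b≤h+k : a + b ≤ h + k
    a+b≤h+k = ≤-trans (≤-trans (m≤m+n (a + b) a′) (m≤m+n _ b′)) cost
    2c≤lin : 2 * c ≤ lin a b
    2c≤lin = m+o≡n⇒m≤n (lin a′ b′ + j * c) (trans (expand c (lin a′ b′) j) (sym E))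
      where
      expand : ∀ c L j → 2 * c + (L + j * c) ≡ L + suc (suc j) * c
      expand = solve-∀

  quotient≤k : ∀ r q → r + q * t ≤ t * k → q ≤ k
  quotient≤k r q x≤t*k = *-cancelʳ-≤ q k t (begin
    q * t        ≤⟨ m≤n+m (q * t) r ⟩
    r + q * t    ≤⟨ x≤t*k ⟩
    t * k        ≡⟨ *-comm t k ⟩
    k * t        ∎)
    where open ≤-Reasoning

  quotient<k : ∀ r q → 1 ≤ r → r + q * t ≤ t * k → q < k
  quotient<k r q 1≤r x≤t*k = *-cancelʳ-< t q k (begin-strict
    q * t        <⟨ m<n+m (q * t) 1≤r ⟩
    r + q * t    ≤⟨ x≤t*k ⟩
    t * k        ≡⟨ *-comm t k ⟩
    k * t        ∎)
    where open ≤-Reasoning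

  representable-even : ∀ s q → s * 2 < t → s * 2 + q * t ≤ t * k →
                       Representable (h + k) (s * 2 + q * t)
  representable-even s q s*2<t x≤t*k = s , q , 0 , 0 , subst (_≤ h + k) (sym (+0+0 s q)) (cost s s*2<t x≤t*k) , commute s q t
    where
    +0+0 : ∀ s q → s + q + 0 + 0 ≡ s + q
    +0+0 = solve-∀
    commute : ∀ s q t → s * 2 + q * t + (2 * 0 + t * 0) ≡ 2 * s + t * q
    commute = solve-∀
    cost : ∀ s → s * 2 < t → s * 2 + q * t ≤ t * k → s + q ≤ h + k
    cost zero     _ x≤t*k = ≤-trans (quotient≤k 0 q x≤t*k) (m≤n+m k h)
    cost (suc s′) s*2<t x≤t*k = begin
      suc s′ + q     ≤⟨ +-monoˡ-≤ q s<h+2 ⟩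
      suc h + q      ≡⟨ +-suc h q ⟨
      h + suc q      ≤⟨ +-monoʳ-≤ h (quotient<k (suc s′ * 2) q (s≤s z≤n) x≤t*k) ⟩
      h + k          ∎
      where
      open ≤-Reasoning
      s<h+2 : suc s′ ≤ suc h
      s<h+2 = s≤s⁻¹ (*-cancelʳ-< 2 (suc s′) (suc (suc h)) (<-≤-trans s*2<t (m+o≡n⇒m≤n 1 (double h))))
        where
        double : ∀ h → 3 + 2 * h + 1 ≡ suc (suc h) * 2
        double = solve-∀

  representable-odd : 2 ≤ k → ∀ s q → suc (s * 2) < t → suc (s * 2) + q * t ≤ t * k →
                      Representable (h + k) (suc (s * 2) + q * t)
  representable-odd 2≤k s q r<t x≤t*k = witness s q s≤h (quotient<k (suc (s * 2)) q (s≤s z≤n) x≤t*k)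
    where
    s≤h : s ≤ h
    s≤h = s≤s⁻¹ (*-cancelʳ-< 2 s (suc h) (subst (suc (s * 2) ≤_) (double h) (s≤s⁻¹ r<t)))
      where
      double : ∀ h → suc (suc (2 * h)) ≡ suc h * 2
      double = solve-∀
    witness : ∀ s q → s ≤ h → q < k → Representable (h + k) (suc (s * 2) + q * t)
    witness (suc s′) q s≤h q<k with w , s+w≡h ← m≤n⇒∃[o]m+o≡n s≤h =
      0 , suc q , suc w , 0 , subst (_≤ h + k) (reorder q w) (+-mono-≤ w<h q<k) ,
      subst (λ h → suc (suc s′ * 2) + q * (3 + 2 * h) + (2 * suc w + (3 + 2 * h) * 0) ≡ 2 * 0 + (3 + 2 * h) * suc q)
            s+w≡h (complete s′ w q)
      where
      w<h : suc w ≤ h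
      w<h = subst (suc w ≤_) s+w≡h (s≤s (m≤n+m w s′))
      reorder : ∀ q w → suc w + suc q ≡ 0 + suc q + suc w + 0
      reorder = solve-∀
      complete : ∀ s′ w q → suc (suc s′ * 2) + q * (3 + 2 * (suc s′ + w)) + (2 * suc w + (3 + 2 * (suc s′ + w)) * 0)
                            ≡ 2 * 0 + (3 + 2 * (suc s′ + w)) * suc q
      complete = solve-∀
    witness zero (suc q′) _ q<k =
      h + 2 , q′ , 0 , 0 , subst (_≤ h + k) (reorder h q′) (+-monoʳ-≤ h q<k) , borrow h q′
      where
      reorder : ∀ h q′ → h + suc (suc q′) ≡ h + 2 + q′ + 0 + 0
      reorder = solve-∀
      borrow : ∀ h q′ → suc (0 * 2) + suc q′ * (3 + 2 * h) + (2 * 0 + (3 + 2 * h) * 0) ≡ 2 * (h + 2) + (3 + 2 * h) * q′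
      borrow = solve-∀
    witness zero zero _ _ =
      0 , 1 , h + 1 , 0 , subst (_≤ h + k) (reorder h) (+-monoʳ-≤ h 2≤k) , complete h
      where
      reorder : ∀ h → h + 2 ≡ 0 + 1 + (h + 1) + 0
      reorder = solve-∀
      complete : ∀ h → suc (0 * 2) + 0 * (3 + 2 * h) + (2 * (h + 1) + (3 + 2 * h) * 0) ≡ 2 * 0 + (3 + 2 * h) * 1
      complete = solve-∀

  representable : 2 ≤ k → ∀ x → x ≤ t * k → Representable (h + k) x
  representable 2≤k x x≤t*k with x divMod t
  ... | result q r x≡r+q*t with toℕ r divMod 2
  ...   | result s zero r≡s*2 =
    subst (Representable (h + k)) (sym x≡) (representable-even s q (subst (_< t) r≡s*2 (Fin.toℕ<n r)) (subst (_≤ t * k) x≡ x≤t*k))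
    where
    x≡ : x ≡ s * 2 + q * t
    x≡ = trans x≡r+q*t (cong (_+ q * t) r≡s*2)
  ...   | result s (suc zero) r≡1+s*2 =
    subst (Representable (h + k)) (sym x≡) (representable-odd 2≤k s q (subst (_< t) r≡1+s*2 (Fin.toℕ<n r)) (subst (_≤ t * k) x≡ x≤t*k))
    where
    x≡ : x ≡ suc (s * 2) + q * t
    x≡ = trans x≡r+q*t (cong (_+ q * t) r≡1+s*2)

  lin-mod⇒≡ : h ≤ k → ∀ a b a′ b′ → a + b + a′ + b′ ≤ h + k →
              lin a b ≡ lin a′ b′ [mod c ] → lin a b ≡ lin a′ b′
  lin-mod⇒≡ h≤k a b a′ b′ cost e with mod⇒+* e
  ... | inj₁ (j , E) = no-wrap h≤k a b a′ b′ j cost E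
  ... | inj₂ (j , E) = sym (no-wrap h≤k a′ b′ a b j (subst (_≤ h + k) (reorder a b a′ b′) cost) E)
    where
    reorder : ∀ a b a′ b′ → a + b + a′ + b′ ≡ a′ + b′ + a + b
    reorder = solve-∀

close-vertices⇒colours≥ : ∀ {V : Set} {Adj : V → V → Set} {d c K} (f : Fin c → V) →
  (∀ {i j} → f i ≡ f j → i ≡ j) → (∀ {i j} → toℕ i < toℕ j → DistLe Adj (f i) (f j) d) →
  HasDistColoring Adj d K → c ≤ K
close-vertices⇒colours≥ {c = c} {K} f f-injective f-close (colour , proper) with c ≤? K
... | yes c≤K = c≤K
... | no  c≰K with i , j , i<j , same ← Fin.pigeonhole (≰⇒> c≰K) (colour ∘ f) =
  ⊥-elim (proper (f i) (f j) (λ fi≡fj → Fin.<-irrefl (f-injective fi≡fj) i<j) same (f-close i<j))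

module DistanceColouring (h k m′ : ℕ) where

  open Arithmetic h k
  open LinearCombination 2 t
  open Circulant 2 t (t * k + m′ * c)

  residue : Fin n → Fin c
  residue u = toℕ u mod c

  residue-isDistColoring : h ≤ k → IsDistColoring Adj (h + k) c residue
  residue-isDistColoring h≤k u v u≢v same-residue (ℓ , ℓ≤h+k , walk) = contradict (walk⇒lin-mod walk)
    where
    u≈v[c] : toℕ u ≡ toℕ v [mod c ]
    u≈v[c] = %≡⇒mod (begin
      toℕ u % c            ≡⟨ Fin.toℕ-fromℕ< (m%n<n (toℕ u) c) ⟨
      toℕ (residue u)      ≡⟨ cong toℕ same-residue ⟩
      toℕ (residue v)      ≡⟨ Fin.toℕ-fromℕ< (m%n<n (toℕ v) c) ⟩
      toℕ v % c            ∎)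
      where open ≡-Reasoning
    contradict : (∃₂ λ a b → ∃₂ λ a′ b′ → a + b + a′ + b′ ≡ ℓ × ((toℕ u + lin a b) ≡ toℕ v + lin a′ b′ [mod n ])) → ⊥
    contradict (a , b , a′ , b′ , length , u+lin≈v+lin′) = u≢v (mod⇒vertex≡ (+-cancelʳ-mod (lin a b) (begin
      toℕ u + lin a b      ≈⟨ u+lin≈v+lin′ ⟩
      toℕ v + lin a′ b′    ≡⟨ cong (toℕ v +_) lin≡lin′ ⟨
      toℕ v + lin a b      ∎)))
      where
      open ModReasoning n
      lin≡lin′ : lin a b ≡ lin a′ b′
      lin≡lin′ = lin-mod⇒≡ h≤k a b a′ b′ (subst (_≤ h + k) (sym length) ℓ≤h+k)
                   (+-cancelˡ-mod u≈v[c] (*-mod⇒mod (suc m′) c u+lin≈v+lin′))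

  c≤n : c ≤ n
  c≤n = m≤m+n c (m′ * c)

  segment : Fin c → Fin n
  segment i = inject≤ i c≤n

  segment-close : 2 ≤ k → ∀ {i j} → toℕ i < toℕ j → DistLe Adj (segment i) (segment j) (h + k)
  segment-close 2≤k {i} {j} i<j = representable⇒DistLe (representable 2≤k _ x≤t*k) (≡⇒mod (begin
    toℕ (segment i) + (toℕ j ∸ toℕ i)   ≡⟨ cong (_+ (toℕ j ∸ toℕ i)) (Fin.toℕ-inject≤ i c≤n) ⟩
    toℕ i + (toℕ j ∸ toℕ i)             ≡⟨ m+[n∸m]≡n (<⇒≤ i<j) ⟩
    toℕ j                               ≡⟨ Fin.toℕ-inject≤ j c≤n ⟨
    toℕ (segment j)                     ∎))
    where
    open ≡-Reasoning
    x≤t*k : toℕ j ∸ toℕ i ≤ t * k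
    x≤t*k = ≤-trans (m∸n≤m (toℕ j) (toℕ i)) (s≤s⁻¹ (Fin.toℕ<n j))

  segment-injective : ∀ {i j} → segment i ≡ segment j → i ≡ j
  segment-injective {i} {j} e = Fin.toℕ-injective (begin
    toℕ i             ≡⟨ Fin.toℕ-inject≤ i c≤n ⟨
    toℕ (segment i)   ≡⟨ cong toℕ e ⟩
    toℕ (segment j)   ≡⟨ Fin.toℕ-inject≤ j c≤n ⟩
    toℕ j             ∎)
    where open ≡-Reasoning

  chiDist : h ≤ k → 2 ≤ k → ChiDist Adj (h + k) c
  chiDist h≤k 2≤k = (residue , residue-isDistColoring h≤k) ,
    λ K → close-vertices⇒colours≥ segment segment-injective (segment-close 2≤k)

module ColouringSearch (K : ℕ) (conflict : ℕ → ℕ → Bool) where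

  -- cs lists the colours of the vertices i ∸ 1, …, 1, 0, most recent first.
  admissible : ℕ → ℕ → List ℕ → Bool
  admissible i c []        = true
  admissible i c (c′ ∷ cs) = (not (conflict i (length cs)) ∨ not (c ≡ᵇ c′)) ∧ admissible i c cs

  extendable : ℕ → ℕ → List ℕ → Bool
  extendable zero    i cs = true
  extendable (suc r) i cs = any (λ c → admissible i c cs ∧ extendable r (suc i) (c ∷ cs)) (upTo K)

  colourable : ℕ → Bool
  colourable N = extendable N 0 []

  colourable-complete : ∀ N (g : ℕ → ℕ) → (∀ i → g i < K) →
    (∀ {i j} → j < i → i < N → T (conflict i j) → g i ≢ g j) → T (colourable N)
  colourable-complete N g g<K proper = extendable-prefix N 0 ≤-refl
    where
    admissible-prefix : ∀ {i} → i < N → ∀ j → j ≤ i → T (admissible i (g i) (applyDownFrom g j))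
    admissible-prefix i<N zero    _   = _
    admissible-prefix {i} i<N (suc j) j<i rewrite length-applyDownFrom g j =
      Equivalence.from T-∧ (compatible , admissible-prefix i<N j (<⇒≤ j<i))
      where
      compatible : T (not (conflict i j) ∨ not (g i ≡ᵇ g j))
      compatible with conflict i j in conflicting | g i ≡ᵇ g j in same
      ... | false | _     = _
      ... | true  | false = _
      ... | true  | true  = proper j<i i<N (Equivalence.from T-≡ conflicting) (≡ᵇ⇒≡ (g i) (g j) (Equivalence.from T-≡ same))
    extendable-prefix : ∀ r i → i + r ≤ N → T (extendable r i (applyDownFrom g i))
    extendable-prefix zero    i _      = _
    extendable-prefix (suc r) i i+r<N  = any⁺ _ (lose (∈-upTo⁺ (g<K i)) (Equivalence.from T-∧
      (admissible-prefix (<-≤-trans (m<m+n i (s≤s z≤n)) i+r<N) i ≤-refl ,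
       extendable-prefix r (suc i) (subst (_≤ N) (+-suc i r) i+r<N))))

-- The positive values of 2a + 5b − 2a′ − 5b′ with a + b + a′ + b′ ≤ 2.
twoStep? : ℕ → Bool
twoStep? 2  = true
twoStep? 3  = true
twoStep? 4  = true
twoStep? 5  = true
twoStep? 7  = true
twoStep? 10 = true
twoStep? _  = false

module SmallCase (m′ : ℕ) where

  open LinearCombination 2 5
  open Circulant 2 5 (5 + m′ * 6)

  twoStep-representable : ∀ x → T (twoStep? x) → Representable 2 x
  twoStep-representable 2  _ = 1 , 0 , 0 , 0 , s≤s z≤n , refl
  twoStep-representable 3  _ = 0 , 1 , 1 , 0 , s≤s (s≤s z≤n) , refl
  twoStep-representable 4  _ = 2 , 0 , 0 , 0 , s≤s (s≤s z≤n) , refl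
  twoStep-representable 5  _ = 0 , 1 , 0 , 0 , s≤s z≤n , refl
  twoStep-representable 7  _ = 1 , 1 , 0 , 0 , s≤s (s≤s z≤n) , refl
  twoStep-representable 10 _ = 0 , 2 , 0 , 0 , s≤s (s≤s z≤n) , refl

  toℕ-vertex< : ∀ {x} → x < n → toℕ (vertex x) ≡ x
  toℕ-vertex< {x} x<n = trans (Fin.toℕ-fromℕ< (m%n<n x n)) (m<n⇒m%n≡m x<n)

  twoStep-close : ∀ {i j} → j ≤ i → T (twoStep? (i ∸ j)) → DistLe Adj (vertex j) (vertex i) 2
  twoStep-close {i} {j} j≤i near = representable⇒DistLe (twoStep-representable _ near) (begin
    toℕ (vertex j) + (i ∸ j)   ≈⟨ +-congʳ-mod (i ∸ j) (toℕ-vertex j) ⟩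
    j + (i ∸ j)                ≡⟨ m+[n∸m]≡n j≤i ⟩
    i                          ≈⟨ toℕ-vertex i ⟨
    toℕ (vertex i)             ∎)
    where open ModReasoning n

  twoStep-close⁻ : ∀ {i j} → j ≤ i → i ≤ n → T (twoStep? (n ∸ (i ∸ j))) → DistLe Adj (vertex j) (vertex i) 2
  twoStep-close⁻ {i} {j} j≤i i≤n near = representable⇒DistLe⁻ (twoStep-representable _ near) (begin
    toℕ (vertex i) + (n ∸ (i ∸ j))       ≈⟨ +-congʳ-mod (n ∸ (i ∸ j)) (toℕ-vertex i) ⟩
    i + (n ∸ (i ∸ j))                    ≡⟨ cong (_+ (n ∸ (i ∸ j))) (m+[n∸m]≡n j≤i) ⟨
    j + (i ∸ j) + (n ∸ (i ∸ j))          ≡⟨ +-assoc j (i ∸ j) _ ⟩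
    j + ((i ∸ j) + (n ∸ (i ∸ j)))        ≡⟨ cong (j +_) (m+[n∸m]≡n (≤-trans (m∸n≤m i j) i≤n)) ⟩
    j + n                                ≈⟨ 0 , 1 , wrap j n ⟩
    j                                    ≈⟨ toℕ-vertex j ⟨
    toℕ (vertex j)                       ∎)
    where
    open ModReasoning n
    wrap : ∀ j n → j + n + 0 * n ≡ j + 1 * n
    wrap = solve-∀

  twoStepMod? : ℕ → ℕ → Bool
  twoStepMod? i j = twoStep? (i ∸ j) ∨ twoStep? (n ∸ (i ∸ j))

  twoStepMod?-close : ∀ {i j} → j < i → i < n → T (twoStepMod? i j) → DistLe Adj (vertex j) (vertex i) 2
  twoStepMod?-close {i} {j} j<i i<n near with Equivalence.to T-∨ near
  ... | inj₁ near⁺ = twoStep-close (<⇒≤ j<i) near⁺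
  ... | inj₂ near⁻ = twoStep-close⁻ (<⇒≤ j<i) (<⇒≤ i<n) near⁻

  colours≥6 : ∀ N (conflict : ℕ → ℕ → Bool) → N ≤ n →
    (∀ {i j} → j < i → i < N → T (conflict i j) → DistLe Adj (vertex j) (vertex i) 2) →
    ¬ T (ColouringSearch.colourable 5 conflict N) → ∀ K → HasDistColoring Adj 2 K → 6 ≤ K
  colours≥6 N conflict N≤n close uncolourable K (f , proper) with 6 ≤? K
  ... | yes 6≤K = 6≤K
  ... | no  6≰K = ⊥-elim (uncolourable (ColouringSearch.colourable-complete 5 conflict N g g<5 g-proper))
    where
    g : ℕ → ℕ
    g i = toℕ (f (vertex i))
    g<5 : ∀ i → g i < 5
    g<5 i = ≤-trans (Fin.toℕ<n (f (vertex i))) (s≤s⁻¹ (≰⇒> 6≰K))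
    g-proper : ∀ {i j} → j < i → i < N → T (conflict i j) → g i ≢ g j
    g-proper {i} {j} j<i i<N near gi≡gj =
      proper (vertex j) (vertex i) vj≢vi (Fin.toℕ-injective (sym gi≡gj)) (close j<i i<N near)
      where
      i<n : i < n
      i<n = <-≤-trans i<N N≤n
      vj≢vi : vertex j ≢ vertex i
      vj≢vi e = <⇒≢ j<i (begin
        j                ≡⟨ toℕ-vertex< (<-trans j<i i<n) ⟨
        toℕ (vertex j)   ≡⟨ cong toℕ e ⟩
        toℕ (vertex i)   ≡⟨ toℕ-vertex< i<n ⟩
        i                ∎)
        where open ≡-Reasoning

smallCase-chiDist : ∀ m′ → ChiDist (CircAdj (suc m′ * 6) (2 ∷ 5 ∷ [])) 2 6
smallCase-chiDist m′ = (residue , residue-isDistColoring ≤-refl) , lower m′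
  where
  open DistanceColouring 1 1 m′ using (residue; residue-isDistColoring)
  lower : ∀ m′ K → HasDistColoring (CircAdj (suc m′ * 6) (2 ∷ 5 ∷ [])) 2 K → 6 ≤ K
  lower 0 = SmallCase.colours≥6 0 6 (SmallCase.twoStepMod? 0) ≤-refl
              (λ j<i i<6 → SmallCase.twoStepMod?-close 0 j<i i<6) (λ ())
  lower 1 = SmallCase.colours≥6 1 12 (SmallCase.twoStepMod? 1) ≤-refl
              (λ j<i i<12 → SmallCase.twoStepMod?-close 1 j<i i<12) (λ ())
  -- For n ≥ 18 the integer differences alone already exclude 5 colours on 16 vertices.
  lower (suc (suc m″)) = SmallCase.colours≥6 (2 + m″) 16 (λ i j → twoStep? (i ∸ j)) (m≤m+n 16 _)
              (λ j<i _ → SmallCase.twoStep-close (2 + m″) (<⇒≤ j<i)) (λ ())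

chiDist-h+k : ∀ h k m′ → 1 ≤ h → h ≤ k →
  ChiDist (CircAdj (suc m′ * (1 + (3 + 2 * h) * k)) (2 ∷ (3 + 2 * h) ∷ [])) (h + k) (1 + (3 + 2 * h) * k)
chiDist-h+k h             (suc (suc k)) m′ _ h≤k = DistanceColouring.chiDist h (2 + k) m′ h≤k (s≤s (s≤s z≤n))
chiDist-h+k 1             1             m′ _ _   = smallCase-chiDist m′
chiDist-h+k (suc (suc h)) 1             m′ _ (s≤s ())
chiDist-h+k (suc h)       0             m′ _ ()

odd⇒3+2* : ∀ t → t ≥ 5 → t % 2 ≡ 1 → ∃ λ h → 1 ≤ h × t ≡ 3 + 2 * h
odd⇒3+2* t t≥5 t%2≡1 = from-quotient (t / 2) (trans (m≡m%n+[m/n]*n t 2) (cong (_+ t / 2 * 2) t%2≡1))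
  where
  from-quotient : ∀ q → t ≡ 1 + q * 2 → ∃ λ h → 1 ≤ h × t ≡ 3 + 2 * h
  from-quotient 0 t≡1 with s≤s () ← subst (5 ≤_) t≡1 t≥5
  from-quotient 1 t≡3 with s≤s (s≤s (s≤s ())) ← subst (5 ≤_) t≡3 t≥5
  from-quotient (suc (suc h)) t≡ = suc h , s≤s z≤n , trans t≡ (regroup h)
    where
    regroup : ∀ h → 1 + suc (suc h) * 2 ≡ 3 + 2 * suc h
    regroup = solve-∀

corollary15 : ∀ (t d m : ℕ) → t ≥ 5 → t % 2 ≡ 1 → d ≥ t ∸ 3 → m ≥ 1 →
    ChiDist (CircAdj (m * (1 + t * (d ∸ (t ∸ 3) / 2))) (2 ∷ t ∷ [])) d (1 + t * (d ∸ (t ∸ 3) / 2))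
corollary15 t d zero _ _ _ ()
corollary15 t d (suc m′) t≥5 t%2≡1 d≥t∸3 _ with h , 1≤h , refl ← odd⇒3+2* t t≥5 t%2≡1 =
  subst₂ P (sym (trans (cong (_/ 2) (*-comm 2 h)) (m*n/n≡m h 2))) (m+[n∸m]≡n h≤d) (chiDist-h+k h (d ∸ h) m′ 1≤h h≤d∸h)
  where
  P : ℕ → ℕ → Set
  P e d′ = ChiDist (CircAdj (suc m′ * (1 + (3 + 2 * h) * (d ∸ e))) (2 ∷ (3 + 2 * h) ∷ [])) d′ (1 + (3 + 2 * h) * (d ∸ e))
  h+h≤d : h + h ≤ d
  h+h≤d = subst (_≤ d) (cong (h +_) (+-identityʳ h)) d≥t∸3
  h≤d : h ≤ d
  h≤d = ≤-trans (m≤m+n h h) h+h≤d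
  h≤d∸h : h ≤ d ∸ h
  h≤d∸h = m+n≤o⇒m≤o∸n h h+h≤d
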